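{- Let $m,n$ be positive integers and let $\pi$ be an $m\times n$ rectangular path with area word $(a_1,\dots,a_n)$. Then \[ \mathrm{cdinv}(\pi)=\mathrm{pdinv}(\pi)-\mathrm{maxtdinv}(\pi)-\#\{\,i\mid a_i<0\,\}-\#\left\{\,i\;\middle|\; a_i<-\tfrac{m}{n}\,\right\}. \]
   Context: An $m\times n$ rectangular path is a lattice path from $(0,0)$ to $(m,n)$ made of unit North and East steps and ending with an East step (it need not stay above the diagonal). The main diagonal is the line $my=nx$. If the $i$-th North step ($1\le i\le n$) starts at the point $(x_i,i-1)$, set $a_i=\frac{m}{n}(i-1)-x_i$ (the signed horizontal distance from the start of the $i$-th North step to the main diagonal, positive when the point lies to the left of the diagonal); $(a_1,\dots,a_n)$ is the area word. Attack relation: for $1\le i,j\le n$, $i$ attacks $j$ if $(a_i,i)<_{\mathrm{lex}}(a_j,j)<_{\mathrm{lex}}(a_i+\frac{m}{n},i)$ in lexicographic order. $\mathrm{maxtdinv}(\pi)$ is the number of pairs $(i,j)$ with $i$ attacking $j$. The unit cells of the rectangle $[0,m]\times[0,n]$ lying above $\pi$ form the Young diagram of a partition $\mu(\pi)$ (rows are the rows of the grid, the longest row at the top). For a cell $c\in\mu(\pi)$, its arm $a=a(c)$ is the number of cells of $\mu(\pi)$ strictly to its right in its row, and its leg $\ell=\ell(c)$ is the number of cells of $\mu(\pi)$ strictly below it in its column. $\mathrm{pdinv}(\pi)$ is the number of cells $c\in\mu(\pi)$ with $\frac{a}{\ell+1}\le\frac{m}{n}<\frac{a+1}{\ell}$,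 where the second inequality is considered to hold when $\ell=0$ (equivalently, $an\le m(\ell+1)$ and $m\ell<(a+1)n$). $\mathrm{cdinv}(\pi)=\#\{c\in\mu(\pi)\mid \frac{a+1}{\ell+1}\le\frac{m}{n}<\frac{a}{\ell}\}-\#\{c\in\mu(\pi)\mid \frac{a}{\ell}\le\frac{m}{n}<\frac{a+1}{\ell+1}\}$, where inequalities are understood after clearing denominators, i.e. the first set is $\{(a+1)n\le m(\ell+1),\ m\ell<an\}$ and the second is $\{an\le m\ell,\ m(\ell+1)<(a+1)n\}$. -}

module Defs where

open import Data.Bool using (Bool; true; false; if_then_else_; _∧_; _∨_)
open import Data.Nat as ℕ using (ℕ; zero; suc; _+_; _*_; _∸_)
open import Data.Integer as ℤ using (ℤ; +_)
open import Data.List using (List; []; _∷_; length; filter; upTo; sum; map)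
open import Data.Product using (_×_; _,_)
open import Relation.Nullary.Decidable using (⌊_⌋)
open import Relation.Binary.PropositionalEquality using (_≡_)

data Step : Set where
  N E : Step

countN : List Step → ℕ
countN []      = 0
countN (N ∷ s) = suc (countN s)
countN (E ∷ s) = countN s

countE : List Step → ℕ
countE []      = 0
countE (N ∷ s) = countE s
countE (E ∷ s) = suc (countE s)

data EndsWithE : List Step → Set where
  endE  : EndsWithE (E ∷ [])
  cons  : ∀ {s} t → EndsWithE s → EndsWithE (t ∷ s)

record RectPath (m n : ℕ) : Set where
  constructor rectPath
  field
    steps   : List Step
    east#   : countE steps ≡ m
    north#  : countN steps ≡ n
    lastE   : EndsWithE steps
open RectPath public

northXsFrom : ℕ → List Step → List ℕ
northXsFrom x []      = []
northXsFrom x (N ∷ s) = x ∷ northXsFrom x s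
northXsFrom x (E ∷ s) = northXsFrom (suc x) s

nth : List ℕ → ℕ → ℕ
nth []       _       = 0
nth (x ∷ _)  zero    = x
nth (_ ∷ xs) (suc k) = nth xs k

-- x-coordinate x_{k+1} of the start of the (k+1)-th North step (k is 0-based)
xN : ∀ {m n} → RectPath m n → ℕ → ℕ
xN π k = nth (northXsFrom 0 (steps π)) k

cnt : ℕ → (ℕ → Bool) → ℕ
cnt zero    p = 0
cnt (suc b) p = cnt b p + (if p b then 1 else 0)

-- Scaled area word: for 0-based k (i = k+1),
--   nA k = n * a_{k+1} = m*k - n*x_{k+1}   (an integer).
-- Since n > 0, all comparisons among the a_i and multiples of m/n are
-- equivalent to the corresponding comparisons after multiplying by n.
nA : ∀ {m n} → RectPath m n → ℕ → ℤ
nA {m} {n} π k = (+ (m * k)) ℤ.- (+ (n * xN π k))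

lexLt : ℤ × ℕ → ℤ × ℕ → Bool
lexLt (a , i) (b , j) = ⌊ a ℤ.<? b ⌋ ∨ (⌊ a ℤ.≟ b ⌋ ∧ ⌊ i ℕ.<? j ⌋)

-- i attacks j  (0-based indices):  (a_i,i) <lex (a_j,j) <lex (a_i + m/n, i),
-- after multiplying the first components by n.
attacks : ∀ {m n} → RectPath m n → ℕ → ℕ → Bool
attacks {m} π i j =
  lexLt (nA π i , i) (nA π j , j) ∧ lexLt (nA π j , j) (nA π i ℤ.+ + m , i)

sumTo : ℕ → (ℕ → ℕ) → ℕ
sumTo zero    f = 0
sumTo (suc b) f = sumTo b f + f b

maxtdinv : ∀ {m n} → RectPath m n → ℕ
maxtdinv {m} {n} π = sumTo n (λ i → cnt n (λ j → attacks π i j))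

-- The partition μ(π): row k (0-based from the bottom, between y=k and y=k+1)
-- consists of the cells [c,c+1]×[k,k+1] with c < x_{k+1}, i.e. the cells
-- to the left of (above) the path.
armOf : ∀ {m n} → RectPath m n → ℕ → ℕ → ℕ
armOf π k c = xN π k ∸ suc c

legOf : ∀ {m n} → RectPath m n → ℕ → ℕ → ℕ
legOf π k c = cnt k (λ k' → c ℕ.<ᵇ xN π k')

countCells : ∀ {m n} → RectPath m n → (ℕ → ℕ → Bool) → ℕ
countCells {m} {n} π p =
  sumTo n (λ k → cnt (xN π k) (λ c → p (armOf π k c) (legOf π k c)))

_≤b_ : ℕ → ℕ → Bool
a ≤b b = ⌊ a ℕ.≤? b ⌋

_<b_ : ℕ → ℕ → Bool
a <b b = ⌊ a ℕ.<? b ⌋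

pdinv : ∀ {m n} → RectPath m n → ℕ
pdinv {m} {n} π = countCells π (λ a l → ((a * n) ≤b (m * suc l)) ∧ ((m * l) <b (suc a * n)))

cdinvPos : ∀ {m n} → RectPath m n → ℕ
cdinvPos {m} {n} π = countCells π (λ a l → ((suc a * n) ≤b (m * suc l)) ∧ ((m * l) <b (a * n)))

cdinvNeg : ∀ {m n} → RectPath m n → ℕ
cdinvNeg {m} {n} π = countCells π (λ a l → ((a * n) ≤b (m * l)) ∧ ((m * suc l) <b (suc a * n)))

cdinv : ∀ {m n} → RectPath m n → ℤ
cdinv π = + cdinvPos π ℤ.- + cdinvNeg π

negArea : ∀ {m n} → RectPath m n → ℕ
negArea {m} {n} π = cnt n (λ k → ⌊ nA π k ℤ.<? + 0 ⌋)

veryNegArea : ∀ {m n} → RectPath m n → ℕ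
veryNegArea {m} {n} π = cnt n (λ k → ⌊ nA π k ℤ.<? ℤ.- (+ m) ⌋)

-- For a cell with arm a and leg ℓ compare the closed interval [mℓ, m(ℓ+1)] with
-- the half-open interval [an, (a+1)n): the pdinv condition says that they meet, the
-- negative cdinv condition that the first lies inside the second, the positive one
-- that it straddles it.  Case analysis gives meets + inside = straddles + the number
-- of the two endpoints mℓ, m(ℓ+1) lying in [an, (a+1)n), so pdinv − cdinv counts
-- such endpoints over all cells.  This count is computed row by row, by induction on
-- the rows below row k: removing the lowest row i lowers the legs of the cells above
-- it, whose intervals tile [(x_k − x_i)n, x_k n), and the resulting change is exactly
-- whether i and k attack each other in one direction or the other.  What remains for
-- row k are the terms [mk < x_k n] and [m(k+1) < x_k n], i.e. [a_k < 0] and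
-- [a_k < −m/n].

module Submission where

open import Defs
open import Data.Nat using (ℕ; NonZero)
open import Data.Integer using (+_; _-_)
open import Relation.Binary.PropositionalEquality using (_≡_)

open import Data.Bool using (Bool; true; false; if_then_else_; _∧_; _∨_; T)
open import Data.Bool.Properties using (∧-zeroʳ; ∨-identityʳ)
open import Data.Unit using (tt)
open import Data.Nat as ℕ using (zero; suc; _+_; _*_; _∸_; _≤_; _<_; z≤n; s≤s; _<ᵇ_)
open import Data.Nat.Properties
open import Data.Integer as ℤ using (ℤ)
import Data.Integer.Properties as ℤₚ
import Data.Integer.Tactic.RingSolver as ℤ-Solver
open import Data.Nat.Tactic.RingSolver using (solve-∀)
open import Data.List using (_∷_)
open import Data.Product using (_,_)
open import Data.Sum using (inj₁; inj₂)
open import Function using (_∘_; _⇔_; mk⇔)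
open import Relation.Nullary using (Dec; yes; no; contradiction)
open import Relation.Nullary.Decidable using (⌊_⌋; isYes≗does; does-⇔; dec-true; dec-false)
open import Relation.Binary.PropositionalEquality using (refl; sym; trans; cong; cong₂; subst; subst₂; module ≡-Reasoning)

𝟙 : Bool → ℕ
𝟙 b = if b then 1 else 0

cnt≡sumTo𝟙 : ∀ b p → cnt b p ≡ sumTo b (𝟙 ∘ p)
cnt≡sumTo𝟙 zero    p = refl
cnt≡sumTo𝟙 (suc b) p = cong (_+ 𝟙 (p b)) (cnt≡sumTo𝟙 b p)

sumTo-+ : ∀ b f g → sumTo b (λ i → f i + g i) ≡ sumTo b f + sumTo b g
sumTo-+ zero    f g = refl
sumTo-+ (suc b) f g = trans (cong (_+ (f b + g b)) (sumTo-+ b f g)) (+-interchange (sumTo b f) (sumTo b g) (f b) (g b))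
  where
  +-interchange : ∀ a c d e → a + c + (d + e) ≡ a + d + (c + e)
  +-interchange = solve-∀

sumTo-cong : ∀ b {f g} → (∀ {i} → i < b → f i ≡ g i) → sumTo b f ≡ sumTo b g
sumTo-cong zero    f≗g = refl
sumTo-cong (suc b) f≗g = cong₂ _+_ (sumTo-cong b (f≗g ∘ m≤n⇒m≤1+n)) (f≗g ≤-refl)

sumTo-suc : ∀ b f → sumTo (suc b) f ≡ f 0 + sumTo b (f ∘ suc)
sumTo-suc zero    f = sym (+-identityʳ _)
sumTo-suc (suc b) f = trans (cong (_+ f (suc b)) (sumTo-suc b f)) (+-assoc (f 0) _ _)

cnt-suc : ∀ b p → cnt (suc b) p ≡ 𝟙 (p 0) + cnt b (p ∘ suc)
cnt-suc b p = trans (cnt≡sumTo𝟙 (suc b) p) (trans (sumTo-suc b (𝟙 ∘ p)) (cong (_+_ (𝟙 (p 0))) (sym (cnt≡sumTo𝟙 b (p ∘ suc)))))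

sumTo-truncate : ∀ {y} X f → y ≤ X → (∀ {c} → y ≤ c → f c ≡ 0) → sumTo X f ≡ sumTo y f
sumTo-truncate zero    f z≤n _ = refl
sumTo-truncate (suc X) f y≤1+X f≗0 with m≤n⇒m<n∨m≡n y≤1+X
... | inj₂ refl     = refl
... | inj₁ (s≤s y≤X) = trans (cong (_+_ (sumTo X f)) (f≗0 y≤X)) (trans (+-identityʳ _) (sumTo-truncate X f y≤X f≗0))

cnt-all : ∀ q p → (∀ {i} → i < q → p i ≡ true) → cnt q p ≡ q
cnt-all zero    p all = refl
cnt-all (suc q) p all = begin
  cnt q p + 𝟙 (p q) ≡⟨ cong₂ (λ c b → c + 𝟙 b) (cnt-all q p (all ∘ m≤n⇒m≤1+n)) (all ≤-refl) ⟩
  q + 1             ≡⟨ +-comm q 1 ⟩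
  suc q             ∎
  where open ≡-Reasoning

cnt-pairs : ∀ Q (f : ℕ → ℕ → Bool) → (∀ i → f i i ≡ false) →
  sumTo Q (λ i → cnt Q (f i)) ≡ sumTo Q (λ k → cnt k (λ i → f i k) + cnt k (f k))
cnt-pairs zero    f irrefl = refl
cnt-pairs (suc Q) f irrefl = begin
  sumTo Q (λ i → cnt Q (f i) + 𝟙 (f i Q)) + (cnt Q (f Q) + 𝟙 (f Q Q))
    ≡⟨ cong₂ _+_ (sumTo-+ Q _ _) (cong (λ b → cnt Q (f Q) + 𝟙 b) (irrefl Q)) ⟩
  sumTo Q (λ i → cnt Q (f i)) + sumTo Q (λ i → 𝟙 (f i Q)) + (cnt Q (f Q) + 0)
    ≡⟨ cong₂ (λ a b → a + b + (cnt Q (f Q) + 0)) (cnt-pairs Q f irrefl) (sym (cnt≡sumTo𝟙 Q (λ i → f i Q))) ⟩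
  Σ< + cnt Q (λ i → f i Q) + (cnt Q (f Q) + 0)
    ≡⟨ cong (_+_ (Σ< + cnt Q (λ i → f i Q))) (+-identityʳ _) ⟩
  Σ< + cnt Q (λ i → f i Q) + cnt Q (f Q)
    ≡⟨ +-assoc Σ< _ _ ⟩
  Σ< + (cnt Q (λ i → f i Q) + cnt Q (f Q)) ∎
  where
  open ≡-Reasoning
  Σ< = sumTo Q (λ k → cnt k (λ i → f i k) + cnt k (f k))

isYes-⇔ : ∀ {A B : Set} → A ⇔ B → (a? : Dec A) (b? : Dec B) → ⌊ a? ⌋ ≡ ⌊ b? ⌋
isYes-⇔ A⇔B a? b? = trans (isYes≗does a?) (trans (does-⇔ A⇔B a? b?) (sym (isYes≗does b?)))

<b-cancelˡ : ∀ k a b → ((k + a) <b (k + b)) ≡ (a <b b)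
<b-cancelˡ k a b = isYes-⇔ (mk⇔ (+-cancelˡ-< k a b) (+-monoʳ-< k)) (k + a ℕ.<? k + b) (a ℕ.<? b)

<ᵇ-true : ∀ {c y} → c < y → (c <ᵇ y) ≡ true
<ᵇ-true {c} {y} = dec-true (c ℕ.<? y)

<ᵇ-false : ∀ {c y} → y ≤ c → (c <ᵇ y) ≡ false
<ᵇ-false {c} {y} y≤c = dec-false (c ℕ.<? y) (≤⇒≯ y≤c)

<ᵇ-sound : ∀ {c y} → (c <ᵇ y) ≡ true → c < y
<ᵇ-sound {c} {y} c<ᵇy = <ᵇ⇒< c y (subst T (sym c<ᵇy) tt)

≤b-cancelˡ : ∀ k a b → ((k + a) ≤b (k + b)) ≡ (a ≤b b)
≤b-cancelˡ k a b = isYes-⇔ (mk⇔ (+-cancelˡ-≤ k a b) (+-monoʳ-≤ k)) (k + a ℕ.≤? k + b) (a ℕ.≤? b)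

infix 4 _∈[_,_⟩

_∈[_,_⟩ : ℕ → ℕ → ℕ → Bool
v ∈[ lo , hi ⟩ = (lo ≤b v) ∧ (v <b hi)

∈[⟩-empty : ∀ a v → (v ∈[ a , a ⟩) ≡ false
∈[⟩-empty a v with a ℕ.≤? v | v ℕ.<? a
... | yes a≤v | yes v<a = contradiction a≤v (<⇒≱ v<a)
... | yes _   | no _    = refl
... | no _    | _       = refl

∈[⟩-split : ∀ {α β γ} v → α ≤ β → β ≤ γ →
  𝟙 (v ∈[ β , γ ⟩) + 𝟙 (v ∈[ α , β ⟩) ≡ 𝟙 (v ∈[ α , γ ⟩)
∈[⟩-split {α} {β} {γ} v α≤β β≤γ with β ℕ.≤? v | v ℕ.<? γ | α ℕ.≤? v | v ℕ.<? β
... | yes β≤v | _       | _       | yes v<β = contradiction β≤v (<⇒≱ v<β)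
... | yes β≤v | _       | no α≰v  | _       = contradiction (≤-trans α≤β β≤v) α≰v
... | no β≰v  | _       | _       | no v≮β  = contradiction (≮⇒≥ v≮β) β≰v
... | no _    | no v≮γ  | yes _   | yes v<β = contradiction (<-≤-trans v<β β≤γ) v≮γ
... | yes _   | yes _   | yes _   | no _    = refl
... | yes _   | no _    | yes _   | no _    = refl
... | no _    | yes _   | yes _   | yes _   = refl
... | no _    | yes _   | no _    | yes _   = refl
... | no _    | no _    | no _    | yes _   = refl

meets+inside≡straddles+endpoints : ∀ {X Y U V} → X ≤ Y → U ≤ V →
  𝟙 ((X ≤b V) ∧ (U <b Y)) + 𝟙 ((X ≤b U) ∧ (V <b Y)) ≡
  𝟙 ((Y ≤b V) ∧ (U <b X)) + (𝟙 (U ∈[ X , Y ⟩) + 𝟙 (V ∈[ X , Y ⟩))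
meets+inside≡straddles+endpoints {X} {Y} {U} {V} X≤Y U≤V
  with X ℕ.≤? U | U ℕ.<? X | X ℕ.≤? V | V ℕ.<? Y | Y ℕ.≤? V | U ℕ.<? Y
... | yes X≤U | yes U<X | _       | _       | _       | _       = contradiction X≤U (<⇒≱ U<X)
... | no X≰U  | no U≮X  | _       | _       | _       | _       = contradiction (≰⇒> X≰U) U≮X
... | yes X≤U | no _    | no X≰V  | _       | _       | _       = contradiction (≤-trans X≤U U≤V) X≰V
... | _       | _       | _       | yes V<Y | yes Y≤V | _       = contradiction Y≤V (<⇒≱ V<Y)
... | _       | _       | _       | no V≮Y  | no Y≰V  | _       = contradiction (≰⇒> Y≰V) V≮Y
... | _       | _       | _       | yes V<Y | no _    | no U≮Y  = contradiction (≤-<-trans U≤V V<Y) U≮Y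
... | no X≰U  | yes _   | yes _   | no _    | yes _   | no U≮Y  = contradiction (<-≤-trans (≰⇒> X≰U) X≤Y) U≮Y
... | no _    | yes _   | no X≰V  | no V≮Y  | yes _   | _       = contradiction (≤-trans X≤Y (≮⇒≥ V≮Y)) X≰V
... | yes _   | no _    | yes _   | yes _   | no _    | yes _   = refl
... | yes _   | no _    | yes _   | no _    | yes _   | yes _   = refl
... | yes _   | no _    | yes _   | no _    | yes _   | no _    = refl
... | no _    | yes _   | yes _   | yes _   | no _    | yes _   = refl
... | no _    | yes _   | yes _   | no _    | yes _   | yes _   = refl
... | no _    | yes _   | no _    | yes _   | no _    | yes _   = refl

∈[⟩-endpoint-exchange : ∀ {P Q s t} → P ≤ Q → s ≤ t →
  𝟙 ((P ≤b t) ∧ (s <b P)) + 𝟙 (t <b Q) + 𝟙 (s ∈[ P , Q ⟩) ≡ 𝟙 (s <b Q) + 𝟙 (t ∈[ P , Q ⟩)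
∈[⟩-endpoint-exchange {P} {Q} {s} {t} P≤Q s≤t
  with P ℕ.≤? s | s ℕ.<? P | P ℕ.≤? t | t ℕ.<? Q | s ℕ.<? Q
... | yes P≤s | yes s<P | _       | _       | _       = contradiction P≤s (<⇒≱ s<P)
... | no P≰s  | no s≮P  | _       | _       | _       = contradiction (≰⇒> P≰s) s≮P
... | yes P≤s | no _    | no P≰t  | _       | _       = contradiction (≤-trans P≤s s≤t) P≰t
... | yes _   | no _    | yes _   | yes t<Q | no s≮Q  = contradiction (≤-<-trans s≤t t<Q) s≮Q
... | no _    | yes s<P | _       | _       | no s≮Q  = contradiction (<-≤-trans s<P P≤Q) s≮Q
... | no _    | yes _   | no P≰t  | no t≮Q  | yes _   = contradiction (<-≤-trans (≰⇒> P≰t) P≤Q) t≮Q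
... | yes _   | no _    | yes _   | yes _   | yes _   = refl
... | yes _   | no _    | yes _   | no _    | yes _   = refl
... | yes _   | no _    | yes _   | no _    | no _    = refl
... | no _    | yes _   | yes _   | yes _   | yes _   = refl
... | no _    | yes _   | yes _   | no _    | yes _   = refl
... | no _    | yes _   | no _    | yes _   | yes _   = refl

ℤ-window-split : ∀ a b (M : ℕ) →
  𝟙 (⌊ a ℤ.≤? b ⌋ ∧ ⌊ b ℤ.<? a ℤ.+ + M ⌋) + 𝟙 (⌊ b ℤ.<? a ⌋ ∧ ⌊ a ℤ.≤? b ℤ.+ + M ⌋)
    ≡ 𝟙 (⌊ a ℤ.≤? b ℤ.+ + M ⌋ ∧ ⌊ b ℤ.<? a ℤ.+ + M ⌋)
ℤ-window-split a b M with a ℤ.≤? b | b ℤ.<? a | a ℤ.≤? b ℤ.+ + M | b ℤ.<? a ℤ.+ + M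
... | yes a≤b | yes b<a | _      | _         = contradiction a≤b (ℤₚ.<⇒≱ b<a)
... | no a≰b  | no b≮a  | _      | _         = contradiction (ℤₚ.≰⇒> a≰b) b≮a
... | yes a≤b | no _    | no a≰b+M | _       = contradiction (ℤₚ.≤-trans a≤b (ℤₚ.i≤i+j b (+ M))) a≰b+M
... | no _    | yes b<a | _      | no b≮a+M  = contradiction (ℤₚ.<-≤-trans b<a (ℤₚ.i≤i+j a (+ M))) b≮a+M
... | yes _   | no _    | yes _  | yes _     = refl
... | yes _   | no _    | yes _  | no _      = refl
... | no _    | yes _   | yes _  | yes _     = refl
... | no _    | yes _   | no _   | yes _     = refl

∈[⟩-tiling : ∀ n {y X} v → y ≤ X →
  sumTo y (λ c → 𝟙 (v ∈[ (X ∸ suc c) * n , suc (X ∸ suc c) * n ⟩)) ≡ 𝟙 (v ∈[ (X ∸ y) * n , X * n ⟩)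
∈[⟩-tiling n {zero}  {X} v _   = cong 𝟙 (sym (∈[⟩-empty (X * n) v))
∈[⟩-tiling n {suc y} {X} v y<X = begin
  sumTo y (λ c → 𝟙 (v ∈[ (X ∸ suc c) * n , suc (X ∸ suc c) * n ⟩)) + 𝟙 (v ∈[ a * n , suc a * n ⟩)
    ≡⟨ cong (_+ 𝟙 (v ∈[ a * n , suc a * n ⟩)) (∈[⟩-tiling n v (<⇒≤ y<X)) ⟩
  𝟙 (v ∈[ (X ∸ y) * n , X * n ⟩) + 𝟙 (v ∈[ a * n , suc a * n ⟩)
    ≡⟨ cong (λ b → 𝟙 (v ∈[ b * n , X * n ⟩) + 𝟙 (v ∈[ a * n , suc a * n ⟩)) X∸y≡1+a ⟩
  𝟙 (v ∈[ suc a * n , X * n ⟩) + 𝟙 (v ∈[ a * n , suc a * n ⟩)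
    ≡⟨ ∈[⟩-split v (*-monoˡ-≤ n (n≤1+n a)) (*-monoˡ-≤ n (subst (_≤ X) X∸y≡1+a (m∸n≤m X y))) ⟩
  𝟙 (v ∈[ a * n , X * n ⟩) ∎
  where
  open ≡-Reasoning
  a = X ∸ suc y
  X∸y≡1+a : X ∸ y ≡ suc a
  X∸y≡1+a = +-∸-assoc 1 y<X

-- A row of cells above a staircase of lower rows

module RowCount (m n : ℕ) where

  endpointHits : ℕ → ℕ → ℕ
  endpointHits a l = 𝟙 (m * l ∈[ a * n , suc a * n ⟩) + 𝟙 (m * suc l ∈[ a * n , suc a * n ⟩)

  -- Rows i and i + p with x-coordinates differing by d attack each other in some direction.
  attackGap : ℕ → ℕ → Bool
  attackGap p d = ((d * n) ≤b (m * suc p)) ∧ ((m * p) <b (m + d * n))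

  -- Row q of length X, above rows of lengths y 0 ≤ … ≤ y (q ∸ 1).
  rowCells : ℕ → (ℕ → ℕ) → ℕ → ℕ
  rowCells q y X = sumTo X (λ c → endpointHits (X ∸ suc c) (cnt q (λ i → c <ᵇ y i)))

  rowTotal : ℕ → (ℕ → ℕ) → ℕ → ℕ
  rowTotal q y X = sumTo q (λ i → 𝟙 (attackGap (q ∸ i) (X ∸ y i)))
                   + 𝟙 ((m * q) <b (X * n)) + 𝟙 ((m * suc q) <b (X * n))

  sumTo-endpointHits : ∀ {y} X l → y ≤ X →
    sumTo y (λ c → endpointHits (X ∸ suc c) l)
      ≡ 𝟙 (m * l ∈[ (X ∸ y) * n , X * n ⟩) + 𝟙 (m * suc l ∈[ (X ∸ y) * n , X * n ⟩)
  sumTo-endpointHits {y} X l y≤X =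
    trans (sumTo-+ y _ _) (cong₂ _+_ (∈[⟩-tiling n (m * l) y≤X) (∈[⟩-tiling n (m * suc l) y≤X))

  leftOf : ℕ → ℕ → ℕ → ℕ
  leftOf y X l = sumTo X (λ c → if c <ᵇ y then endpointHits (X ∸ suc c) l else 0)

  leftOf≡ : ∀ {y} X l → y ≤ X →
    leftOf y X l ≡ 𝟙 (m * l ∈[ (X ∸ y) * n , X * n ⟩) + 𝟙 (m * suc l ∈[ (X ∸ y) * n , X * n ⟩)
  leftOf≡ {y} X l y≤X = begin
    leftOf y X l
      ≡⟨ sumTo-truncate X _ y≤X (λ {c} y≤c → cong (λ b → if b then endpointHits (X ∸ suc c) l else 0) (<ᵇ-false y≤c)) ⟩
    sumTo y (λ c → if c <ᵇ y then endpointHits (X ∸ suc c) l else 0)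
      ≡⟨ sumTo-cong y (λ {c} c<y → cong (λ b → if b then endpointHits (X ∸ suc c) l else 0) (<ᵇ-true c<y)) ⟩
    sumTo y (λ c → endpointHits (X ∸ suc c) l)
      ≡⟨ sumTo-endpointHits X l y≤X ⟩
    _ ∎
    where open ≡-Reasoning

  -- Deleting the lowest row lowers by one exactly the legs of the cells in columns c < y 0.
  rowCells-peel : ∀ q y X → (∀ {i} → i < suc q → y 0 ≤ y i) →
    rowCells (suc q) y X + leftOf (y 0) X q ≡ rowCells q (y ∘ suc) X + leftOf (y 0) X (suc q)
  rowCells-peel q y X y₀-least =
    trans (sym (sumTo-+ X _ _)) (trans (sumTo-cong X (λ {c} _ → cell c)) (sumTo-+ X _ _))
    where
    cell : ∀ c →
      endpointHits (X ∸ suc c) (cnt (suc q) (λ i → c <ᵇ y i)) + (if c <ᵇ y 0 then endpointHits (X ∸ suc c) q else 0)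
        ≡ endpointHits (X ∸ suc c) (cnt q (λ i → c <ᵇ y (suc i))) + (if c <ᵇ y 0 then endpointHits (X ∸ suc c) (suc q) else 0)
    cell c rewrite cnt-suc q (λ i → c <ᵇ y i) with c <ᵇ y 0 in c<ᵇy₀
    ... | false = refl
    ... | true rewrite cnt-all q (λ i → c <ᵇ y (suc i))
                         (λ i<q → <ᵇ-true (<-≤-trans (<ᵇ-sound c<ᵇy₀) (y₀-least (s≤s i<q)))) =
        +-comm (endpointHits (X ∸ suc c) (suc q)) (endpointHits (X ∸ suc c) q)

  attackGap-exchange : ∀ q {d X} → d ≤ X →
    𝟙 (attackGap (suc q) d) + 𝟙 ((m * suc (suc q)) <b (X * n)) + 𝟙 (m * q ∈[ d * n , X * n ⟩)
      ≡ 𝟙 ((m * q) <b (X * n)) + 𝟙 (m * suc (suc q) ∈[ d * n , X * n ⟩)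
  attackGap-exchange q {d} {X} d≤X =
    trans (cong (λ b → 𝟙 (((d * n) ≤b (m * suc (suc q))) ∧ b) + 𝟙 ((m * suc (suc q)) <b (X * n))
                         + 𝟙 (m * q ∈[ d * n , X * n ⟩)) cancel-m)
          (∈[⟩-endpoint-exchange (*-monoˡ-≤ n d≤X) (*-monoʳ-≤ m (≤-trans (n≤1+n q) (n≤1+n (suc q)))))
    where
    cancel-m : ((m * suc q) <b (m + d * n)) ≡ ((m * q) <b (d * n))
    cancel-m = trans (cong (λ v → v <b (m + d * n)) (*-suc m q)) (<b-cancelˡ m (m * q) (d * n))

  rowCells≡rowTotal : ∀ q y X → (∀ {i} → i < q → y i ≤ X) → (∀ {i j} → i ≤ j → j < q → y i ≤ y j) →
    rowCells q y X ≡ rowTotal q y X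
  rowCells≡rowTotal zero y X _ _ =
    trans (sumTo-endpointHits X 0 ≤-refl)
          (cong (λ b → 𝟙 (m * 0 ∈[ b * n , X * n ⟩) + 𝟙 (m * 1 ∈[ b * n , X * n ⟩)) (n∸n≡0 X))
  rowCells≡rowTotal (suc q) y X y≤X y-mono = +-cancelʳ-≡ (S₀ + S₁) _ _ (begin
    rowCells (suc q) y X + (S₀ + S₁)            ≡⟨ cong (_+_ (rowCells (suc q) y X)) (sym (leftOf≡ X q y₀≤X)) ⟩
    rowCells (suc q) y X + leftOf y₀ X q         ≡⟨ rowCells-peel q y X (y-mono z≤n) ⟩
    rowCells q (y ∘ suc) X + leftOf y₀ X (suc q) ≡⟨ cong₂ _+_ IH (leftOf≡ X (suc q) y₀≤X) ⟩
    Σ' + e₀ + e₁ + (S₁ + S₂)                    ≡⟨ regroup₁ Σ' e₀ e₁ S₁ S₂ ⟩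
    Σ' + e₁ + S₁ + (e₀ + S₂)                    ≡⟨ cong (_+_ (Σ' + e₁ + S₁)) (sym (attackGap-exchange q (m∸n≤m X y₀))) ⟩
    Σ' + e₁ + S₁ + (A + e₂ + S₀)                ≡⟨ regroup₂ Σ' e₁ S₁ A e₂ S₀ ⟩
    A + Σ' + e₁ + e₂ + (S₀ + S₁)                ≡⟨ cong (λ s → s + e₁ + e₂ + (S₀ + S₁)) (sym (sumTo-suc q _)) ⟩
    rowTotal (suc q) y X + (S₀ + S₁)            ∎)
    where
    open ≡-Reasoning
    y₀ = y 0
    y₀≤X : y₀ ≤ X
    y₀≤X = y≤X (s≤s z≤n)
    Σ' A e₀ e₁ e₂ S₀ S₁ S₂ : ℕ
    Σ' = sumTo q (λ i → 𝟙 (attackGap (q ∸ i) (X ∸ y (suc i))))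
    A  = 𝟙 (attackGap (suc q) (X ∸ y₀))
    e₀ = 𝟙 ((m * q) <b (X * n))
    e₁ = 𝟙 ((m * suc q) <b (X * n))
    e₂ = 𝟙 ((m * suc (suc q)) <b (X * n))
    S₀ = 𝟙 (m * q ∈[ (X ∸ y₀) * n , X * n ⟩)
    S₁ = 𝟙 (m * suc q ∈[ (X ∸ y₀) * n , X * n ⟩)
    S₂ = 𝟙 (m * suc (suc q) ∈[ (X ∸ y₀) * n , X * n ⟩)
    IH : rowCells q (y ∘ suc) X ≡ Σ' + e₀ + e₁
    IH = rowCells≡rowTotal q (y ∘ suc) X (y≤X ∘ s≤s) (λ i≤j j<q → y-mono (s≤s i≤j) (s≤s j<q))
    regroup₁ : ∀ a b c d e → a + b + c + (d + e) ≡ a + c + d + (b + e)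
    regroup₁ = solve-∀
    regroup₂ : ∀ a b c d e f → a + b + c + (d + e + f) ≡ d + a + b + e + (f + c)
    regroup₂ = solve-∀

-- Attacks and the area word

lexLt-irrefl : ∀ a i → lexLt (a , i) (a , i) ≡ false
lexLt-irrefl a i with a ℤ.<? a | i ℕ.<? i
... | yes a<a | _       = contradiction a<a (ℤₚ.<-irrefl refl)
... | no _    | yes i<i = contradiction i<i (<-irrefl refl)
... | no _    | no _    = ∧-zeroʳ ⌊ a ℤ.≟ a ⌋

lexLt-< : ∀ a b {i k} → i < k → lexLt (a , i) (b , k) ≡ ⌊ a ℤ.≤? b ⌋
lexLt-< a b {i} {k} i<k with i ℕ.<? k
... | no i≮k = contradiction i<k i≮k
... | yes _ with a ℤ.<? b | a ℤ.≟ b | a ℤ.≤? b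
...   | yes _   | _        | yes _   = refl
...   | yes a<b | _        | no a≰b  = contradiction (ℤₚ.<⇒≤ a<b) a≰b
...   | no _    | yes refl | yes _   = refl
...   | no _    | yes refl | no a≰a  = contradiction ℤₚ.≤-refl a≰a
...   | no a≮b  | no a≢b   | yes a≤b = contradiction (ℤₚ.≤∧≢⇒< a≤b a≢b) a≮b
...   | no _    | no _     | no _    = refl

lexLt-> : ∀ a b {i k} → k < i → lexLt (a , i) (b , k) ≡ ⌊ a ℤ.<? b ⌋
lexLt-> a b {i} {k} k<i with i ℕ.<? k
... | yes i<k = contradiction i<k (<-asym k<i)
... | no _    = trans (cong (⌊ a ℤ.<? b ⌋ ∨_) (∧-zeroʳ ⌊ a ℤ.≟ b ⌋)) (∨-identityʳ ⌊ a ℤ.<? b ⌋)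

lexLt-pair : ∀ a b (M : ℕ) {i k} → i < k →
  𝟙 (lexLt (a , i) (b , k) ∧ lexLt (b , k) (a ℤ.+ + M , i))
    + 𝟙 (lexLt (b , k) (a , i) ∧ lexLt (a , i) (b ℤ.+ + M , k))
    ≡ 𝟙 (⌊ a ℤ.≤? b ℤ.+ + M ⌋ ∧ ⌊ b ℤ.<? a ℤ.+ + M ⌋)
lexLt-pair a b M i<k
  rewrite lexLt-< a b i<k | lexLt-> b (a ℤ.+ + M) i<k | lexLt-> b a i<k | lexLt-< a (b ℤ.+ + M) i<k
  = ℤ-window-split a b M

private
  cancel-subtrahends : ∀ (A B D : ℤ) → (A - B) ℤ.+ (B ℤ.+ D) ≡ A ℤ.+ D
  cancel-subtrahends = ℤ-Solver.solve-∀
  cancel-subtrahends′ : ∀ (C D B : ℤ) → (C - D) ℤ.+ (B ℤ.+ D) ≡ C ℤ.+ B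
  cancel-subtrahends′ = ℤ-Solver.solve-∀
  restore-subtrahends : ∀ (A B D : ℤ) → (A ℤ.+ D) ℤ.+ (ℤ.- B - D) ≡ A - B
  restore-subtrahends = ℤ-Solver.solve-∀
  restore-subtrahends′ : ∀ (C B D : ℤ) → (C ℤ.+ B) ℤ.+ (ℤ.- B - D) ≡ C - D
  restore-subtrahends′ = ℤ-Solver.solve-∀

diff-≤-diff : ∀ a b c d → (+ a - + b ℤ.≤ + c - + d) ⇔ (a + d ≤ c + b)
diff-≤-diff a b c d = mk⇔
  (λ le → ℤₚ.drop‿+≤+ (subst₂ ℤ._≤_ (cancel-subtrahends (+ a) (+ b) (+ d)) (cancel-subtrahends′ (+ c) (+ d) (+ b))
                        (ℤₚ.+-monoˡ-≤ (+ b ℤ.+ + d) le)))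
  (λ le → subst₂ ℤ._≤_ (restore-subtrahends (+ a) (+ b) (+ d)) (restore-subtrahends′ (+ c) (+ b) (+ d))
            (ℤₚ.+-monoˡ-≤ (ℤ.- + b - + d) (ℤ.+≤+ le)))

diff-<-diff : ∀ a b c d → (+ a - + b ℤ.< + c - + d) ⇔ (a + d < c + b)
diff-<-diff a b c d = mk⇔
  (λ lt → ℤₚ.drop‿+<+ (subst₂ ℤ._<_ (cancel-subtrahends (+ a) (+ b) (+ d)) (cancel-subtrahends′ (+ c) (+ d) (+ b))
                        (ℤₚ.+-monoˡ-< (+ b ℤ.+ + d) lt)))
  (λ lt → subst₂ ℤ._<_ (restore-subtrahends (+ a) (+ b) (+ d)) (restore-subtrahends′ (+ c) (+ b) (+ d))
            (ℤₚ.+-monoˡ-< (ℤ.- + b - + d) (ℤ.+<+ lt)))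

module AreaWord (m n : ℕ) where
  open RowCount m n using (attackGap)

  -- nA π i is areaAt i (xN π i).
  areaAt : ℕ → ℕ → ℤ
  areaAt i x = + (m * i) - + (n * x)

  private
    sub-+-comm : ∀ (C D M : ℤ) → (C - D) ℤ.+ M ≡ (C ℤ.+ M) - D
    sub-+-comm = ℤ-Solver.solve-∀

  areaAt-lower : ∀ i p xi d → ⌊ areaAt i xi ℤ.≤? areaAt (i + p) (xi + d) ℤ.+ + m ⌋ ≡ ((d * n) ≤b (m * suc p))
  areaAt-lower i p xi d = begin
    ⌊ areaAt i xi ℤ.≤? areaAt (i + p) (xi + d) ℤ.+ + m ⌋
      ≡⟨ cong (λ z → ⌊ areaAt i xi ℤ.≤? z ⌋) (sub-+-comm (+ (m * (i + p))) (+ (n * (xi + d))) (+ m)) ⟩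
    ⌊ areaAt i xi ℤ.≤? + (m * (i + p) + m) - + (n * (xi + d)) ⌋
      ≡⟨ isYes-⇔ (diff-≤-diff (m * i) (n * xi) (m * (i + p) + m) (n * (xi + d))) _ _ ⟩
    (m * i + n * (xi + d)) ≤b (m * (i + p) + m + n * xi)
      ≡⟨ cong₂ _≤b_ (lhs m i n xi d) (rhs m i p n xi) ⟩
    (m * i + n * xi + d * n) ≤b (m * i + n * xi + m * suc p)
      ≡⟨ ≤b-cancelˡ (m * i + n * xi) (d * n) (m * suc p) ⟩
    (d * n) ≤b (m * suc p) ∎
    where
    open ≡-Reasoning
    lhs : ∀ m i n xi d → m * i + n * (xi + d) ≡ m * i + n * xi + d * n
    lhs = solve-∀
    rhs : ∀ m i p n xi → m * (i + p) + m + n * xi ≡ m * i + n * xi + m * suc p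
    rhs = solve-∀

  areaAt-upper : ∀ i p xi d → ⌊ areaAt (i + p) (xi + d) ℤ.<? areaAt i xi ℤ.+ + m ⌋ ≡ ((m * p) <b (m + d * n))
  areaAt-upper i p xi d = begin
    ⌊ areaAt (i + p) (xi + d) ℤ.<? areaAt i xi ℤ.+ + m ⌋
      ≡⟨ cong (λ z → ⌊ areaAt (i + p) (xi + d) ℤ.<? z ⌋) (sub-+-comm (+ (m * i)) (+ (n * xi)) (+ m)) ⟩
    ⌊ areaAt (i + p) (xi + d) ℤ.<? + (m * i + m) - + (n * xi) ⌋
      ≡⟨ isYes-⇔ (diff-<-diff (m * (i + p)) (n * (xi + d)) (m * i + m) (n * xi)) _ _ ⟩
    (m * (i + p) + n * xi) <b (m * i + m + n * (xi + d))
      ≡⟨ cong₂ _<b_ (lhs m i p n xi) (rhs m i n xi d) ⟩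
    (m * i + n * xi + m * p) <b (m * i + n * xi + (m + d * n))
      ≡⟨ <b-cancelˡ (m * i + n * xi) (m * p) (m + d * n) ⟩
    (m * p) <b (m + d * n) ∎
    where
    open ≡-Reasoning
    lhs : ∀ m i p n xi → m * (i + p) + n * xi ≡ m * i + n * xi + m * p
    lhs = solve-∀
    rhs : ∀ m i n xi d → m * i + m + n * (xi + d) ≡ m * i + n * xi + (m + d * n)
    rhs = solve-∀

  areaAt-window : ∀ {i k xi xk} p d → i + p ≡ k → xi + d ≡ xk →
    (⌊ areaAt i xi ℤ.≤? areaAt k xk ℤ.+ + m ⌋ ∧ ⌊ areaAt k xk ℤ.<? areaAt i xi ℤ.+ + m ⌋) ≡ attackGap p d
  areaAt-window {i} {xi = xi} p d refl refl = cong₂ _∧_ (areaAt-lower i p xi d) (areaAt-upper i p xi d)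

  areaAt<0 : ∀ k x → ⌊ areaAt k x ℤ.<? + 0 ⌋ ≡ ((m * k) <b (x * n))
  areaAt<0 k x = trans (isYes-⇔ (diff-<-diff (m * k) (n * x) 0 0) _ _)
                       (cong₂ _<b_ (+-identityʳ (m * k)) (*-comm n x))

  areaAt<-m : ∀ k x → ⌊ areaAt k x ℤ.<? ℤ.- + m ⌋ ≡ ((m * suc k) <b (x * n))
  areaAt<-m k x = begin
    ⌊ areaAt k x ℤ.<? ℤ.- + m ⌋       ≡⟨ cong (λ z → ⌊ areaAt k x ℤ.<? z ⌋) (sym (ℤₚ.+-identityˡ (ℤ.- + m))) ⟩
    ⌊ areaAt k x ℤ.<? + 0 - + m ⌋     ≡⟨ isYes-⇔ (diff-<-diff (m * k) (n * x) 0 m) _ _ ⟩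
    (m * k + m) <b (n * x)            ≡⟨ cong₂ _<b_ (trans (+-comm (m * k) m) (sym (*-suc m k))) (*-comm n x) ⟩
    (m * suc k) <b (x * n)            ∎
    where open ≡-Reasoning

-- The statistics of a rectangular path

northXsFrom-lowerBound : ∀ x s {j} → j < countN s → x ≤ nth (northXsFrom x s) j
northXsFrom-lowerBound x (N ∷ s) {zero}  _         = ≤-refl
northXsFrom-lowerBound x (N ∷ s) {suc j} (s≤s j<) = northXsFrom-lowerBound x s j<
northXsFrom-lowerBound x (E ∷ s)         j<        = ≤-trans (n≤1+n x) (northXsFrom-lowerBound (suc x) s j<)

northXsFrom-monotone : ∀ x s {i j} → i ≤ j → j < countN s → nth (northXsFrom x s) i ≤ nth (northXsFrom x s) j
northXsFrom-monotone x (N ∷ s) {zero}              _         j< = northXsFrom-lowerBound x (N ∷ s) j<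
northXsFrom-monotone x (N ∷ s) {suc i} {suc j} (s≤s i≤j) (s≤s j<) = northXsFrom-monotone x s i≤j j<
northXsFrom-monotone x (E ∷ s)                     i≤j       j< = northXsFrom-monotone (suc x) s i≤j j<

xN-monotone : ∀ {m n} (π : RectPath m n) {i j} → i ≤ j → j < n → xN π i ≤ xN π j
xN-monotone π i≤j j<n = northXsFrom-monotone 0 (steps π) i≤j (subst (_ <_) (sym (north# π)) j<n)

module _ {m n : ℕ} (π : RectPath m n) where
  open RowCount m n
  open AreaWord m n

  cellSum : (ℕ → ℕ → ℕ) → ℕ
  cellSum f = sumTo n (λ k → sumTo (xN π k) (λ c → f (armOf π k c) (legOf π k c)))

  countCells≡cellSum : ∀ p → countCells π p ≡ cellSum (λ a l → 𝟙 (p a l))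
  countCells≡cellSum p = sumTo-cong n (λ {k} _ → cnt≡sumTo𝟙 (xN π k) _)

  cellSum-+ : ∀ f g → cellSum (λ a l → f a l + g a l) ≡ cellSum f + cellSum g
  cellSum-+ f g = trans (sumTo-cong n (λ {k} _ → sumTo-+ (xN π k) _ _)) (sumTo-+ n _ _)

  cellSum-cong : ∀ {f g} → (∀ a l → f a l ≡ g a l) → cellSum f ≡ cellSum g
  cellSum-cong f≗g = sumTo-cong n (λ {k} _ → sumTo-cong (xN π k) (λ {c} _ → f≗g (armOf π k c) (legOf π k c)))

  pdinv+cdinvNeg≡cdinvPos+endpointHits : pdinv π + cdinvNeg π ≡ cdinvPos π + cellSum endpointHits
  pdinv+cdinvNeg≡cdinvPos+endpointHits = begin
    pdinv π + cdinvNeg π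
      ≡⟨ cong₂ _+_ (countCells≡cellSum meets) (countCells≡cellSum inside) ⟩
    cellSum (λ a l → 𝟙 (meets a l)) + cellSum (λ a l → 𝟙 (inside a l))
      ≡⟨ sym (cellSum-+ (λ a l → 𝟙 (meets a l)) (λ a l → 𝟙 (inside a l))) ⟩
    cellSum (λ a l → 𝟙 (meets a l) + 𝟙 (inside a l))
      ≡⟨ cellSum-cong (λ a l → meets+inside≡straddles+endpoints (m≤n+m (a * n) n) (*-monoʳ-≤ m (n≤1+n l))) ⟩
    cellSum (λ a l → 𝟙 (straddles a l) + endpointHits a l)
      ≡⟨ cellSum-+ (λ a l → 𝟙 (straddles a l)) endpointHits ⟩
    cellSum (λ a l → 𝟙 (straddles a l)) + cellSum endpointHits
      ≡⟨ cong (_+ cellSum endpointHits) (sym (countCells≡cellSum straddles)) ⟩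
    cdinvPos π + cellSum endpointHits ∎
    where
    open ≡-Reasoning
    meets inside straddles : ℕ → ℕ → Bool
    meets     a l = ((a * n) ≤b (m * suc l)) ∧ ((m * l) <b (suc a * n))
    inside    a l = ((a * n) ≤b (m * l)) ∧ ((m * suc l) <b (suc a * n))
    straddles a l = ((suc a * n) ≤b (m * suc l)) ∧ ((m * l) <b (a * n))

  endpointHits≡rowTotals : cellSum endpointHits ≡ sumTo n (λ k → rowTotal k (xN π) (xN π k))
  endpointHits≡rowTotals = sumTo-cong n (λ {k} k<n → rowCells≡rowTotal k (xN π) (xN π k)
    (λ i<k → xN-monotone π (<⇒≤ i<k) k<n) (λ i≤j j<k → xN-monotone π i≤j (<-trans j<k k<n)))

  attacks-pair : ∀ {i k} → i < k → k < n →
    𝟙 (attacks π i k) + 𝟙 (attacks π k i) ≡ 𝟙 (attackGap (k ∸ i) (xN π k ∸ xN π i))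
  attacks-pair {i} {k} i<k k<n = trans (lexLt-pair (nA π i) (nA π k) m i<k)
    (cong 𝟙 (areaAt-window (k ∸ i) (xN π k ∸ xN π i) (m+[n∸m]≡n (<⇒≤ i<k)) (m+[n∸m]≡n (xN-monotone π (<⇒≤ i<k) k<n))))

  maxtdinv≡ : maxtdinv π ≡ sumTo n (λ k → sumTo k (λ i → 𝟙 (attackGap (k ∸ i) (xN π k ∸ xN π i))))
  maxtdinv≡ = trans (cnt-pairs n (attacks π) (λ i → cong (_∧ lexLt (nA π i , i) (nA π i ℤ.+ + m , i)) (lexLt-irrefl (nA π i) i)))
    (sumTo-cong n (λ {k} k<n → trans (cong₂ _+_ (cnt≡sumTo𝟙 k _) (cnt≡sumTo𝟙 k _))
      (trans (sym (sumTo-+ k _ _)) (sumTo-cong k (λ i<k → attacks-pair i<k k<n)))))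

  negArea≡ : negArea π ≡ sumTo n (λ k → 𝟙 ((m * k) <b (xN π k * n)))
  negArea≡ = trans (cnt≡sumTo𝟙 n _) (sumTo-cong n (λ {k} _ → cong 𝟙 (areaAt<0 k (xN π k))))

  veryNegArea≡ : veryNegArea π ≡ sumTo n (λ k → 𝟙 ((m * suc k) <b (xN π k * n)))
  veryNegArea≡ = trans (cnt≡sumTo𝟙 n _) (sumTo-cong n (λ {k} _ → cong 𝟙 (areaAt<-m k (xN π k))))

  rowTotals≡ : sumTo n (λ k → rowTotal k (xN π) (xN π k)) ≡ maxtdinv π + negArea π + veryNegArea π
  rowTotals≡ = begin
    sumTo n (λ k → rowTotal k (xN π) (xN π k))
      ≡⟨ sumTo-+ n (λ k → attackSum k + negTerm k) veryNegTerm ⟩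
    sumTo n (λ k → attackSum k + negTerm k) + sumTo n veryNegTerm
      ≡⟨ cong (_+ sumTo n veryNegTerm) (sumTo-+ n attackSum negTerm) ⟩
    sumTo n attackSum + sumTo n negTerm + sumTo n veryNegTerm
      ≡⟨ sym (cong₂ _+_ (cong₂ _+_ maxtdinv≡ negArea≡) veryNegArea≡) ⟩
    maxtdinv π + negArea π + veryNegArea π ∎
    where
    open ≡-Reasoning
    attackSum negTerm veryNegTerm : ℕ → ℕ
    attackSum   k = sumTo k (λ i → 𝟙 (attackGap (k ∸ i) (xN π k ∸ xN π i)))
    negTerm     k = 𝟙 ((m * k) <b (xN π k * n))
    veryNegTerm k = 𝟙 ((m * suc k) <b (xN π k * n))

+≡+⇒-≡- : ∀ a b c d → a + b ≡ c + d → + c - + b ≡ + a - + d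
+≡+⇒-≡- a b c d a+b≡c+d = begin
  + c - + b                          ≡⟨ expand (+ c) (+ b) (+ d) ⟩
  (+ c ℤ.+ + d) - + b - + d          ≡⟨ cong (λ z → z - + b - + d) (cong +_ (sym a+b≡c+d)) ⟩
  (+ a ℤ.+ + b) - + b - + d          ≡⟨ contract (+ a) (+ b) (+ d) ⟩
  + a - + d                          ∎
  where
  open ≡-Reasoning
  expand : ∀ (C B D : ℤ) → C - B ≡ (C ℤ.+ D) - B - D
  expand = ℤ-Solver.solve-∀
  contract : ∀ (A B D : ℤ) → (A ℤ.+ B) - B - D ≡ A - D
  contract = ℤ-Solver.solve-∀

-[+]≡-- : ∀ (a b c d : ℤ) → a - (b ℤ.+ c ℤ.+ d) ≡ a - b - c - d
-[+]≡-- = ℤ-Solver.solve-∀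

mainTheorem1 : (m n : ℕ) → .{{_ : NonZero m}} → .{{_ : NonZero n}} → (π : RectPath m n) →
    cdinv π ≡ + pdinv π - + maxtdinv π - + negArea π - + veryNegArea π
mainTheorem1 m n π = begin
  + cdinvPos π - + cdinvNeg π                              ≡⟨ +≡+⇒-≡- (pdinv π) (cdinvNeg π) (cdinvPos π) _ statistics ⟩
  + pdinv π - + (maxtdinv π + negArea π + veryNegArea π)   ≡⟨ -[+]≡-- (+ pdinv π) (+ maxtdinv π) (+ negArea π) (+ veryNegArea π) ⟩
  + pdinv π - + maxtdinv π - + negArea π - + veryNegArea π ∎
  where
  open ≡-Reasoning
  open RowCount m n using (endpointHits; rowTotal)
  statistics : pdinv π + cdinvNeg π ≡ cdinvPos π + (maxtdinv π + negArea π + veryNegArea π)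
  statistics = begin
    pdinv π + cdinvNeg π                                    ≡⟨ pdinv+cdinvNeg≡cdinvPos+endpointHits π ⟩
    cdinvPos π + cellSum π endpointHits                     ≡⟨ cong (_+_ (cdinvPos π)) (endpointHits≡rowTotals π) ⟩
    cdinvPos π + sumTo n (λ k → rowTotal k (xN π) (xN π k)) ≡⟨ cong (_+_ (cdinvPos π)) (rowTotals≡ π) ⟩
    cdinvPos π + (maxtdinv π + negArea π + veryNegArea π)   ∎
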